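{- Let $G$ be a connected graph and let $e\in E(G)$ be an edge that is not a bridge of $G$. Then $$\frac{\chi_d^t(G-e)+\chi_d^t(G/e)-3}{2}\leq \chi_d^t(G)\leq \frac{\chi_d^t(G-e)+\chi_d^t(G/e)+3}{2}.$$
   Context: All graphs are simple and finite. For a graph with no isolated vertex, a total dominator coloring (TD-coloring) is a proper vertex coloring in which every vertex is adjacent to every vertex of some color class (a class other than its own); $\chi_d^t$ denotes the minimum number of colors in such a coloring. $G-e$ is $G$ with the edge $e$ deleted. For $e=uv$, the contraction $G/e$ is obtained by replacing $u$ and $v$ by a single new vertex adjacent to every vertex (other than $u,v$) that was adjacent to $u$ or $v$ (no parallel edges or loops). Implicitly, every graph whose $\chi_d^t$ appears has no isolated vertex. -}

module Defs where

open import Data.Nat using (ℕ; suc)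
open import Data.Fin using (Fin; punchOut)
open import Data.Fin.Properties using (_≟_; any?)
open import Data.Product using (Σ; ∃; _×_; _,_; proj₁; proj₂)
open import Data.Sum using (_⊎_; inj₁; inj₂)
open import Relation.Nullary using (¬_; Dec; yes; no)
open import Relation.Nullary.Decidable using (¬?; _×-dec_; _⊎-dec_)
open import Relation.Binary.PropositionalEquality using (_≡_; _≢_; refl; sym; subst)

record Graph (n : ℕ) : Set₁ where
  field
    Adj    : Fin n → Fin n → Set
    adj?   : ∀ a b → Dec (Adj a b)
    adj-sym : ∀ {a b} → Adj a b → Adj b a
    irrefl : ∀ {a} → ¬ Adj a a
open Graph public

SameEdge : ∀ {n} → Fin n → Fin n → Fin n → Fin n → Set
SameEdge u v a b = (a ≡ u × b ≡ v) ⊎ (a ≡ v × b ≡ u)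

sameEdge-swap : ∀ {n} {u v a b : Fin n} → SameEdge u v a b → SameEdge u v b a
sameEdge-swap (inj₁ (p , q)) = inj₂ (q , p)
sameEdge-swap (inj₂ (p , q)) = inj₁ (q , p)

deleteEdge : ∀ {n} → Graph n → Fin n → Fin n → Graph n
deleteEdge G u v = record
  { Adj    = λ a b → Adj G a b × ¬ SameEdge u v a b
  ; adj?   = λ a b → adj? G a b ×-dec ¬? (((a ≟ u) ×-dec (b ≟ v)) ⊎-dec ((a ≟ v) ×-dec (b ≟ u)))
  ; adj-sym = λ { (ab , ne) → adj-sym G ab , λ s → ne (sameEdge-swap s) }
  ; irrefl = λ { (aa , _) → irrefl G aa }
  }

adj⇒≢ : ∀ {n} (G : Graph n) {u v : Fin n} → Adj G u v → u ≢ v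
adj⇒≢ G uv refl = irrefl G uv

-- The quotient map Fin (suc n) → Fin n identifying u and v (u ≢ v):
-- u and v are both sent to the new (merged) vertex, all other vertices
-- are renumbered injectively.
merge : ∀ {n} (u v : Fin (suc n)) → u ≢ v → Fin (suc n) → Fin n
merge u v u≢v w with w ≟ u
... | yes _ = punchOut u≢v
... | no w≢u = punchOut (λ eq → w≢u (sym eq))

-- G / e, for e = uv : two distinct vertices of the contracted graph are
-- adjacent iff some of their preimages are adjacent in G
-- (so the merged vertex is adjacent to N(u) ∪ N(v) minus {u,v};
-- no loops, no parallel edges).
contract : ∀ {n} → Graph (suc n) → (u v : Fin (suc n)) → u ≢ v → Graph n
contract G u v u≢v = record
  { Adj    = A
  ; adj?   = λ a b → ¬? (a ≟ b) ×-dec any? (λ w → any? (λ w' →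
                (q w ≟ a) ×-dec ((q w' ≟ b) ×-dec adj? G w w')))
  ; adj-sym = λ { (a≢b , w , w' , p , p' , e) →
                 (λ eq → a≢b (sym eq)) , w' , w , p' , p , adj-sym G e }
  ; irrefl = λ { (a≢a , _) → a≢a refl }
  }
  where
  q = merge u v u≢v
  A : _ → _ → Set
  A a b = a ≢ b × ∃ λ w → ∃ λ w' → q w ≡ a × q w' ≡ b × Adj G w w'

data Reachable {n} (G : Graph n) : Fin n → Fin n → Set where
  here : ∀ {a} → Reachable G a a
  step : ∀ {a b c} → Adj G a b → Reachable G b c → Reachable G a c

Connected : ∀ {n} → Graph n → Set
Connected G = ∀ a b → Reachable G a b

-- uv is a bridge: deleting it puts u and v in different components,
-- i.e. the number of components increases.
IsBridge : ∀ {n} → Graph n → Fin n → Fin n → Set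
IsBridge G u v = ¬ Reachable (deleteEdge G u v) u v

-- total dominator coloring with (at most) k colours
IsTDColoring : ∀ {n} → Graph n → (k : ℕ) → (Fin n → Fin k) → Set
IsTDColoring G k c =
  (∀ {a b} → Adj G a b → c a ≢ c b) ×
  (∀ x → ∃ λ j → j ≢ c x × (∃ λ w → c w ≡ j) × (∀ w → c w ≡ j → Adj G x w))

HasTDColoring : ∀ {n} → Graph n → ℕ → Set
HasTDColoring {n} G k = ∃ λ (c : Fin n → Fin k) → IsTDColoring G k c

IsTDChromatic : ∀ {n} → Graph n → ℕ → Set
IsTDChromatic G k = HasTDColoring G k × (∀ m → HasTDColoring G m → k Data.Nat.≤ m)

-- Each coloring is obtained from a coloring of the other graph by giving a few vertices
-- a color of their own. A vertex with a private color is a singleton class, so it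
-- dominates all its neighbours; a class that loses it stays dominated unless it becomes
-- empty, and then the vertices that dominated it are adjacent to the recolored vertex.
-- This gives χ(G) ≤ χ(G−e)+1 (isolate u), χ(G) ≤ χ(G/e)+2 (pull the coloring back along
-- the contraction, isolate u and v), χ(G−e) ≤ χ(G)+2 (isolate a neighbour of u and one
-- of v in G−e) and χ(G/e) ≤ χ(G)+1 (restrict the coloring of G, the merged vertex
-- taking v's color, and isolate the merged vertex, which then dominates the class
-- dominated by u or by v; if these classes are {v} and {u}, the colors of u and v are
-- private and are reused instead).
module Submission where

open import Defs
open import Data.Nat using (suc; _+_; _*_; _≤_)
open import Data.Nat.Properties using (+-mono-≤; module ≤-Reasoning)
open import Data.Nat.Tactic.RingSolver using (solve-∀)
open import Data.Fin using (Fin; punchIn; punchOut; inject₁; fromℕ)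
open import Data.Fin.Properties
  using (_≟_; any?; punchInᵢ≢i; punchOut-cong; punchOut-punchIn; punchIn-punchOut; inject₁-injective; fromℕ≢inject₁)
open import Data.Vec.Functional using (updateAt)
open import Data.Vec.Functional.Properties using (updateAt-updates; updateAt-minimal)
open import Data.Product using (∃; _×_; _,_; proj₁; proj₂; uncurry)
open import Data.Sum using (_⊎_; inj₁; inj₂; [_,_]′; map₁)
open import Data.Empty using (⊥-elim)
open import Function using (_∘_; const)
open import Relation.Nullary using (¬_; yes; no)
open import Relation.Nullary.Decidable using (¬?; _×-dec_; toSum)
open import Relation.Binary.PropositionalEquality using (_≡_; _≢_; refl; sym; trans; cong; subst; subst₂)

Proper : ∀ {N K} → Graph N → (Fin N → Fin K) → Set
Proper H c = ∀ {a b} → Adj H a b → c a ≢ c b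

ProperOff : ∀ {N K} → Graph N → (Fin N → Fin K) → Fin N → Set
ProperOff H c w = ∀ {a b} → Adj H a b → a ≢ w → b ≢ w → c a ≢ c b

Dominates : ∀ {N K} → Graph N → (Fin N → Fin K) → Fin N → Fin K → Set
Dominates H c x j = j ≢ c x × (∃ λ y → c y ≡ j) × (∀ y → c y ≡ j → Adj H x y)

Dominated : ∀ {N K} → Graph N → (Fin N → Fin K) → Fin N → Set
Dominated H c x = ∃ (Dominates H c x)

hasTDColoring⇒neighbour : ∀ {N K} (H : Graph N) → HasTDColoring H K → ∀ x → ∃ (Adj H x)
hasTDColoring⇒neighbour H (_ , _ , dominated) x with dominated x
... | _ , _ , (y , cy) , all = y , all y cy

dominated-mono : ∀ {N K} (H H′ : Graph N) {c : Fin N → Fin K} {x} →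
  (∀ {y} → Adj H x y → Adj H′ x y) → Dominated H c x → Dominated H′ c x
dominated-mono H H′ H⊆H′ (j , j≢cx , class , all) = j , j≢cx , class , λ y cy → H⊆H′ (all y cy)

dominated-inject₁ : ∀ {N K} (H : Graph N) {c : Fin N → Fin K} {x} →
  Dominated H c x → Dominated H (inject₁ ∘ c) x
dominated-inject₁ H (j , j≢cx , (y , cy) , all) =
  inject₁ j , j≢cx ∘ inject₁-injective , (y , cong inject₁ cy) , λ y′ → all y′ ∘ inject₁-injective

hasTDColoring-suc : ∀ {N K} (H : Graph N) → HasTDColoring H K → HasTDColoring H (suc K)
hasTDColoring-suc H (c , proper , dominated) =
  inject₁ ∘ c , (λ ab → proper ab ∘ inject₁-injective) , dominated-inject₁ H ∘ dominated

unique-color : ∀ {N K} {c : Fin N → Fin K} {w j} →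
  (∃ λ y → c y ≡ j) → ¬ (∃ λ y → y ≢ w × c y ≡ j) → ∀ y → y ≢ w → c y ≢ c w
unique-color {w = w} (y₀ , cy₀) only-w y y≢w cy≡cw with y₀ ≟ w
... | yes refl = only-w (y , y≢w , trans cy≡cw cy₀)
... | no y₀≢w = only-w (y₀ , y₀≢w , cy₀)

module Recolor {N K} (H : Graph N) (c : Fin N → Fin K) (w : Fin N) (t : Fin K)
  (t-unused : ∀ y → y ≢ w → c y ≢ t) (proper-off : ProperOff H c w) where

  c′ : Fin N → Fin K
  c′ = updateAt c w (const t)

  c′-at : c′ w ≡ t
  c′-at = updateAt-updates w c

  c′-off : ∀ {y} → y ≢ w → c′ y ≡ c y
  c′-off {y} y≢w = updateAt-minimal y w c y≢w

  proper : Proper H c′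
  proper {a} {b} ab with a ≟ w | b ≟ w
  ... | yes refl | yes refl = ⊥-elim (irrefl H ab)
  ... | yes refl | no b≢w rewrite c′-at | c′-off b≢w = t-unused b b≢w ∘ sym
  ... | no a≢w | yes refl rewrite c′-at | c′-off a≢w = t-unused a a≢w
  ... | no a≢w | no b≢w rewrite c′-off a≢w | c′-off b≢w = proper-off ab a≢w b≢w

  class≢t : ∀ {j} → (∃ λ y → y ≢ w × c y ≡ j) → j ≢ t
  class≢t (y , y≢w , cy) refl = t-unused y y≢w cy

  recolored-class : ∀ {y j} → j ≢ t → c′ y ≡ j → y ≢ w × c y ≡ j
  recolored-class {y} j≢t c′y≡j with y ≟ w
  ... | yes refl = ⊥-elim (j≢t (trans (sym c′y≡j) c′-at))
  ... | no y≢w = y≢w , trans (sym (c′-off y≢w)) c′y≡j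

  dominated-by : ∀ x j → j ≢ c′ x → (∃ λ y → y ≢ w × c y ≡ j) →
    (∀ y → y ≢ w → c y ≡ j → Adj H x y) → Dominated H c′ x
  dominated-by x j j≢c′x class@(y , y≢w , cy) all =
    j , j≢c′x , (y , trans (c′-off y≢w) cy) , λ y′ → uncurry (all y′) ∘ recolored-class (class≢t class)

  dominated-at : ∀ j → (∃ λ y → y ≢ w × c y ≡ j) →
    (∀ y → y ≢ w → c y ≡ j → Adj H w y) → Dominated H c′ w
  dominated-at j class = dominated-by w j (λ j≡c′w → class≢t class (trans j≡c′w c′-at)) class

  dominated-adjacent : ∀ {x} → Adj H x w → Dominated H c′ x
  dominated-adjacent {x} xw = t , t≢c′x , (w , c′-at) , member
    where
    x≢w : x ≢ w
    x≢w refl = irrefl H xw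
    t≢c′x : t ≢ c′ x
    t≢c′x t≡c′x = t-unused x x≢w (sym (trans t≡c′x (c′-off x≢w)))
    member : ∀ y → c′ y ≡ t → Adj H x y
    member y c′y≡t with y ≟ w
    ... | yes refl = xw
    ... | no y≢w = ⊥-elim (t-unused y y≢w (trans (sym (c′-off y≢w)) c′y≡t))

  ≢-recolored : ∀ {x j} → j ≢ t → j ≢ c x → j ≢ c′ x
  ≢-recolored {x} j≢t j≢cx with x ≟ w
  ... | yes refl = λ j≡c′w → j≢t (trans j≡c′w c′-at)
  ... | no x≢w = λ j≡c′x → j≢cx (trans j≡c′x (c′-off x≢w))

  -- If w was the only vertex of x's class, then x is adjacent to w.
  dominated : ∀ x → Dominated H c x ⊎ Adj H x w → Dominated H c′ x
  dominated x (inj₂ xw) = dominated-adjacent xw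
  dominated x (inj₁ (j , j≢cx , (y , cy) , all)) with any? (λ y′ → ¬? (y′ ≟ w) ×-dec (c y′ ≟ j))
  ... | yes class = dominated-by x j (≢-recolored (class≢t class) j≢cx) class (λ y′ _ → all y′)
  ... | no no-class = dominated-adjacent (subst (Adj H x) y≡w (all y cy))
    where
    y≡w : y ≡ w
    y≡w with y ≟ w
    ... | yes y≡w = y≡w
    ... | no y≢w = ⊥-elim (no-class (y , y≢w , cy))

module Isolate {N K} (H : Graph N) (c : Fin N → Fin K) (w : Fin N) (proper-off : ProperOff H c w) where

  private
    module R = Recolor H (inject₁ ∘ c) w (fromℕ K) (λ _ _ → fromℕ≢inject₁ ∘ sym)
      (λ ab a≢w b≢w → proper-off ab a≢w b≢w ∘ inject₁-injective)

  open R public using (c′; proper; dominated-at)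

  dominated : ∀ x → Dominated H c x ⊎ Adj H x w → Dominated H c′ x
  dominated x = R.dominated x ∘ map₁ (dominated-inject₁ H)

isolate-twice : ∀ {N K} (H : Graph N) {c : Fin N → Fin K} {w₁ w₂} → ProperOff H c w₁ →
  (∀ x → Dominated H c x ⊎ Adj H x w₁ ⊎ Adj H x w₂) → HasTDColoring H (2 + K)
isolate-twice H {c} {w₁} {w₂} proper-off dominated-or-adjacent = I₂.c′ , I₂.proper , dominated
  where
  module I₁ = Isolate H c w₁ proper-off
  module I₂ = Isolate H I₁.c′ w₂ (λ ab _ _ → I₁.proper ab)
  dominated : ∀ x → Dominated H I₂.c′ x
  dominated x with dominated-or-adjacent x
  ... | inj₁ dom = I₂.dominated x (inj₁ (I₁.dominated x (inj₁ dom)))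
  ... | inj₂ (inj₁ xw₁) = I₂.dominated x (inj₁ (I₁.dominated x (inj₂ xw₁)))
  ... | inj₂ (inj₂ xw₂) = I₂.dominated x (inj₂ xw₂)

module Merge {n} {u v : Fin (suc n)} (u≢v : u ≢ v) where

  q : Fin (suc n) → Fin n
  q = merge u v u≢v

  merge-off : ∀ {w} (w≢u : w ≢ u) → q w ≡ punchOut (w≢u ∘ sym)
  merge-off {w} w≢u with w ≟ u
  ... | yes w≡u = ⊥-elim (w≢u w≡u)
  ... | no _ = punchOut-cong u refl

  merge-punchIn : ∀ z → q (punchIn u z) ≡ z
  merge-punchIn z = trans (merge-off (punchInᵢ≢i u z)) (trans (punchOut-cong u refl) (punchOut-punchIn u))

  punchIn-merge : ∀ {w} → w ≢ u → punchIn u (q w) ≡ w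
  punchIn-merge w≢u = trans (cong (punchIn u) (merge-off w≢u)) (punchIn-punchOut _)

  merge-injective-off-u : ∀ {w y} → w ≢ u → y ≢ u → q w ≡ q y → w ≡ y
  merge-injective-off-u w≢u y≢u qw≡qy =
    trans (sym (punchIn-merge w≢u)) (trans (cong (punchIn u) qw≡qy) (punchIn-merge y≢u))

  merge-u≡merge-v : q u ≡ q v
  merge-u≡merge-v with u ≟ u
  ... | yes _ = trans (punchOut-cong u refl) (sym (merge-off (u≢v ∘ sym)))
  ... | no u≢u = ⊥-elim (u≢u refl)

  merge-unmerged⇒≢u : ∀ {w} → q w ≢ q v → w ≢ u
  merge-unmerged⇒≢u qw≢qv refl = qw≢qv merge-u≡merge-v

  merge≡merge-v : ∀ w → q w ≡ q v → w ≡ u ⊎ w ≡ v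
  merge≡merge-v w qw≡qv with toSum (w ≟ u)
  ... | inj₁ w≡u = inj₁ w≡u
  ... | inj₂ w≢u = inj₂ (merge-injective-off-u w≢u (u≢v ∘ sym) qw≡qv)

  merge-injective : ∀ {w y} → q y ≢ q v → q w ≡ q y → w ≡ y
  merge-injective {w} {y} qy≢qv qw≡qy with toSum (w ≟ u)
  ... | inj₁ refl = ⊥-elim (qy≢qv (trans (sym qw≡qy) merge-u≡merge-v))
  ... | inj₂ w≢u = merge-injective-off-u w≢u (merge-unmerged⇒≢u qy≢qv) qw≡qy

  punchIn≢v : ∀ {z} → z ≢ q v → punchIn u z ≢ v
  punchIn≢v {z} z≢qv pz≡v = z≢qv (trans (sym (merge-punchIn z)) (cong q pz≡v))

module Contraction {n} (G : Graph (suc n)) {u v : Fin (suc n)} (u≢v : u ≢ v) where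

  open Merge u≢v public

  G/ : Graph n
  G/ = contract G u v u≢v

  merged : Fin n
  merged = q v

  contract-adj : ∀ {a b x z} → x ≢ z → q a ≡ x → q b ≡ z → Adj G a b → Adj G/ x z
  contract-adj x≢z qa≡x qb≡z ab = x≢z , _ , _ , qa≡x , qb≡z , ab

  adj-punchIn : ∀ {a b} → Adj G/ a b → a ≢ merged → b ≢ merged → Adj G (punchIn u a) (punchIn u b)
  adj-punchIn (_ , w , w′ , refl , refl , ww′) qw≢m qw′≢m =
    subst₂ (Adj G) (sym (punchIn-merge (merge-unmerged⇒≢u qw≢m)))
                   (sym (punchIn-merge (merge-unmerged⇒≢u qw′≢m))) ww′

  adj-from-image : ∀ {x z} → q x ≢ merged → Adj G/ (q x) z → ∃ λ y → q y ≡ z × Adj G x y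
  adj-from-image qx≢m (_ , w , w′ , qw≡qx , qw′≡z , ww′) =
    w′ , qw′≡z , subst (λ a → Adj G a w′) (merge-injective qx≢m qw≡qx) ww′

module Bounds {n} (G : Graph (suc n)) {u v : Fin (suc n)} (e : Adj G u v) where

  open Contraction G (adj⇒≢ G e) public

  G− : Graph (suc n)
  G− = deleteEdge G u v

  hasTDColoring-undelete : ∀ {k} → HasTDColoring G− k → HasTDColoring G (suc k)
  hasTDColoring-undelete (d , proper , dominated) =
    I.c′ , I.proper , λ x → I.dominated x (inj₁ (dominated-mono G− G proj₁ (dominated x)))
    where
    proper-off : ProperOff G d u
    proper-off ab a≢u b≢u = proper (ab , [ a≢u ∘ proj₁ , b≢u ∘ proj₂ ]′)
    module I = Isolate G d u proper-off

  hasTDColoring-deleteEdge : ∀ {k} → ∃ (Adj G− u) → ∃ (Adj G− v) → HasTDColoring G k → HasTDColoring G− (2 + k)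
  hasTDColoring-deleteEdge (nu , u-nu) (nv , v-nv) (c , proper , dominated) =
    isolate-twice G− (λ ab _ _ → proper (proj₁ ab)) dominated-or-adjacent
    where
    dominated-or-adjacent : ∀ x → Dominated G− c x ⊎ Adj G− x nu ⊎ Adj G− x nv
    dominated-or-adjacent x with x ≟ u | x ≟ v
    ... | yes refl | _ = inj₂ (inj₁ u-nu)
    ... | no _ | yes refl = inj₂ (inj₂ v-nv)
    ... | no x≢u | no x≢v =
      inj₁ (dominated-mono G G− (λ xy → xy , [ x≢u ∘ proj₁ , x≢v ∘ proj₁ ]′) (dominated x))

  hasTDColoring-uncontract : ∀ {k} → HasTDColoring G/ k → HasTDColoring G (2 + k)
  hasTDColoring-uncontract (d , proper , dominated) = isolate-twice G proper-off dominated-or-adjacent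
    where
    proper-off : ProperOff G (d ∘ q) u
    proper-off {a} {b} ab a≢u b≢u = proper (contract-adj qa≢qb refl refl ab)
      where
      qa≢qb : q a ≢ q b
      qa≢qb qa≡qb = adj⇒≢ G ab (merge-injective-off-u a≢u b≢u qa≡qb)

    -- x dominates the preimage of the class q x dominates, unless that class contains merged.
    unmerged : ∀ {x} → q x ≢ merged → Dominated G/ d (q x) → Dominated G (d ∘ q) x ⊎ Adj G x u ⊎ Adj G x v
    unmerged {x} qx≢m (j , j≢dqx , (z , dz) , all) with toSum (d merged ≟ j)
    ... | inj₁ dm≡j with adj-from-image qx≢m (all merged dm≡j)
    ...   | y , qy≡m , xy with merge≡merge-v y qy≡m
    ...     | inj₁ refl = inj₂ (inj₁ xy)
    ...     | inj₂ refl = inj₂ (inj₂ xy)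
    unmerged {x} qx≢m (j , j≢dqx , (z , dz) , all) | inj₂ dm≢j =
      inj₁ (j , j≢dqx , (punchIn u z , trans (cong d (merge-punchIn z)) dz) , member)
      where
      member : ∀ y → d (q y) ≡ j → Adj G x y
      member y dqy≡j with adj-from-image qx≢m (all (q y) dqy≡j)
      ... | y′ , qy′≡qy , xy′ = subst (Adj G x) (merge-injective qy≢m qy′≡qy) xy′
        where
        qy≢m : q y ≢ merged
        qy≢m qy≡m = dm≢j (trans (cong d (sym qy≡m)) dqy≡j)

    dominated-or-adjacent : ∀ x → Dominated G (d ∘ q) x ⊎ Adj G x u ⊎ Adj G x v
    dominated-or-adjacent x with toSum (q x ≟ merged)
    ... | inj₂ qx≢m = unmerged qx≢m (dominated (q x))
    ... | inj₁ qx≡m with merge≡merge-v x qx≡m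
    ...   | inj₁ refl = inj₂ (inj₂ e)
    ...   | inj₂ refl = inj₂ (inj₁ (adj-sym G e))

  module ContractColoring {k} (c : Fin (suc n) → Fin k) (proper : Proper G c)
    (dominated : ∀ x → Dominated G c x) where

    d : Fin n → Fin k
    d = c ∘ punchIn u

    proper-off : ProperOff G/ d merged
    proper-off ab a≢m b≢m = proper (adj-punchIn ab a≢m b≢m)

    dominated-or-adjacent : ∀ x → x ≢ merged → Dominated G/ d x ⊎ Adj G/ x merged
    dominated-or-adjacent x x≢m with dominated (punchIn u x)
    ... | J , J≢ , (y , cy) , all with toSum (c u ≟ J)
    ...   | inj₁ cu≡J = inj₂ (contract-adj x≢m (merge-punchIn x) merge-u≡merge-v (all u cu≡J))
    ...   | inj₂ cu≢J = inj₁ (J , J≢ , (q y , trans (cong c (punchIn-merge y≢u)) cy) , member)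
      where
      y≢u : y ≢ u
      y≢u refl = cu≢J cy
      member : ∀ z → d z ≡ J → Adj G/ x z
      member z dz≡J = contract-adj x≢z (merge-punchIn x) (merge-punchIn z) xz
        where
        xz = all (punchIn u z) dz≡J
        x≢z : x ≢ z
        x≢z refl = irrefl G xz

    -- merged takes over the class J dominated by w₀ ∈ {u, v}, which survives as it has a vertex y ∉ {u, v}.
    via-fresh-color : ∀ {w₀ J y} → q w₀ ≡ merged → (∀ z → c z ≡ J → Adj G w₀ z) →
      y ≢ u → y ≢ v → c y ≡ J → HasTDColoring G/ (suc k)
    via-fresh-color {J = J} {y} qw₀≡m all y≢u y≢v cy≡J = I.c′ , I.proper , dominated′
      where
      module I = Isolate G/ d merged proper-off
      qy≢m : q y ≢ merged
      qy≢m = [ y≢u , y≢v ]′ ∘ merge≡merge-v y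
      member : ∀ z → z ≢ merged → inject₁ (d z) ≡ inject₁ J → Adj G/ merged z
      member z z≢m dz≡J =
        contract-adj (z≢m ∘ sym) qw₀≡m (merge-punchIn z) (all (punchIn u z) (inject₁-injective dz≡J))
      dominated′ : ∀ x → Dominated G/ I.c′ x
      dominated′ x with toSum (x ≟ merged)
      ... | inj₁ refl = I.dominated-at (inject₁ J)
                          (q y , qy≢m , cong inject₁ (trans (cong c (punchIn-merge y≢u)) cy≡J)) member
      ... | inj₂ x≢m = I.dominated x (dominated-or-adjacent x x≢m)

    -- The colors of u and v are private, so merged can take c u and a neighbour of it c v.
    via-private-colors : (∀ y → y ≢ u → c y ≢ c u) → (∀ y → y ≢ v → c y ≢ c v) →
      ∃ (Adj G/ merged) → HasTDColoring G/ k
    via-private-colors private-u private-v (w , m-w) = R₂.c′ , R₂.proper , dominated′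
      where
      module R₁ = Recolor G/ d merged (c u) (λ z _ → private-u (punchIn u z) (punchInᵢ≢i u z)) proper-off
      cv-unused : ∀ z → z ≢ w → R₁.c′ z ≢ c v
      cv-unused z _ with toSum (z ≟ merged)
      ... | inj₁ refl = λ c′m≡cv → proper e (trans (sym R₁.c′-at) c′m≡cv)
      ... | inj₂ z≢m = λ c′z≡cv →
        private-v (punchIn u z) (punchIn≢v z≢m) (trans (sym (R₁.c′-off z≢m)) c′z≡cv)
      module R₂ = Recolor G/ R₁.c′ w (c v) cv-unused (λ ab _ _ → R₁.proper ab)
      dominated′ : ∀ x → Dominated G/ R₂.c′ x
      dominated′ x with toSum (x ≟ merged)
      ... | inj₁ refl = R₂.dominated-adjacent m-w
      ... | inj₂ x≢m = R₂.dominated x (inj₁ (R₁.dominated x (dominated-or-adjacent x x≢m)))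

    hasTDColoring : ∃ (Adj G/ merged) → HasTDColoring G/ (suc k)
    hasTDColoring m-neighbour with dominated u | dominated v
    ... | Ju , Ju≢cu , class-u , all-u | Jv , Jv≢cv , class-v , all-v
      with any? (λ y → ¬? (y ≟ v) ×-dec (c y ≟ Ju)) | any? (λ y → ¬? (y ≟ u) ×-dec (c y ≟ Jv))
    ... | yes (y , y≢v , cy≡Ju) | _ =
      via-fresh-color merge-u≡merge-v all-u (λ { refl → Ju≢cu (sym cy≡Ju) }) y≢v cy≡Ju
    ... | no _ | yes (y , y≢u , cy≡Jv) =
      via-fresh-color refl all-v y≢u (λ { refl → Jv≢cv (sym cy≡Jv) }) cy≡Jv
    ... | no only-v | no only-u =
      hasTDColoring-suc G/ (via-private-colors (unique-color class-v only-u) (unique-color class-u only-v) m-neighbour)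

  hasTDColoring-contract : ∀ {k} → ∃ (Adj G/ merged) → HasTDColoring G k → HasTDColoring G/ (suc k)
  hasTDColoring-contract m-neighbour (c , proper , dominated) =
    ContractColoring.hasTDColoring c proper dominated m-neighbour

upper-bound : ∀ {k k₁ k₂} → k₁ ≤ 2 + k → k₂ ≤ 1 + k → k₁ + k₂ ≤ 2 * k + 3
upper-bound {k} {k₁} {k₂} k₁≤ k₂≤ = begin
  k₁ + k₂           ≤⟨ +-mono-≤ k₁≤ k₂≤ ⟩
  2 + k + (1 + k)   ≡⟨ sum k ⟩
  2 * k + 3         ∎
  where
  open ≤-Reasoning
  sum : ∀ k → 2 + k + (1 + k) ≡ 2 * k + 3
  sum = solve-∀

lower-bound : ∀ {k k₁ k₂} → k ≤ 1 + k₁ → k ≤ 2 + k₂ → 2 * k ≤ k₁ + k₂ + 3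
lower-bound {k} {k₁} {k₂} ≤k₁ ≤k₂ = begin
  2 * k             ≡⟨ double k ⟩
  k + k             ≤⟨ +-mono-≤ ≤k₁ ≤k₂ ⟩
  1 + k₁ + (2 + k₂) ≡⟨ sum k₁ k₂ ⟩
  k₁ + k₂ + 3       ∎
  where
  open ≤-Reasoning
  double : ∀ k → 2 * k ≡ k + k
  double = solve-∀
  sum : ∀ k₁ k₂ → 1 + k₁ + (2 + k₂) ≡ k₁ + k₂ + 3
  sum = solve-∀

corollary3p2 : ∀ {n} (G : Graph (suc n)) (u v : Fin (suc n)) (e : Adj G u v) →
    Connected G → ¬ IsBridge G u v →
    ∀ k k₁ k₂ → IsTDChromatic G k → IsTDChromatic (deleteEdge G u v) k₁ →
    IsTDChromatic (contract G u v (adj⇒≢ G e)) k₂ →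
    (k₁ + k₂ ≤ 2 * k + 3) × (2 * k ≤ k₁ + k₂ + 3)
corollary3p2 G u v e _ _ k k₁ k₂ (colorable , minimal) (colorable₁ , minimal₁) (colorable₂ , minimal₂) =
  upper-bound (minimal₁ _ (hasTDColoring-deleteEdge (neighbour₁ u) (neighbour₁ v) colorable))
              (minimal₂ _ (hasTDColoring-contract (hasTDColoring⇒neighbour G/ colorable₂ merged) colorable)) ,
  lower-bound (minimal _ (hasTDColoring-undelete colorable₁))
              (minimal _ (hasTDColoring-uncontract colorable₂))
  where
  open Bounds G e
  neighbour₁ : ∀ x → ∃ (Adj G− x)
  neighbour₁ = hasTDColoring⇒neighbour G− colorable₁
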